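{- For each integer $m\ge 1$ let $C_m=\det C^{(m)}$, where $C^{(m)}$ is the $m\times m$ matrix with entries $C^{(m)}_{ij}=1$ if $-2\le j-i\le 1$ and $0$ otherwise. For an integer $n\ge 5$ let $K^{(n)}$ be the $n\times n$ matrix whose first row has entries $K^{(n)}_{11}=1$, $K^{(n)}_{1,n-1}=1$ and $K^{(n)}_{1j}=0$ for all other $j$, and whose rows $i=2,\dots,n$ have entries $K^{(n)}_{ij}=1$ if $-2\le j-i\le 1$ and $K^{(n)}_{ij}=0$ otherwise. Let $K_n=\det K^{(n)}$. Then $$K_n = (C_{n-2}-C_{n-3})\bigl(1+(-1)^n\bigr) + C_{n-4}.$$ -}

module Defs where

open import Data.Nat as ℕ using (ℕ; zero; suc)
open import Data.Fin using (Fin; zero; suc; toℕ; punchIn)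
open import Data.Integer using (ℤ; +_; -_; _+_; _*_)
open import Data.Bool using (Bool; true; false; if_then_else_; _∧_)
open import Data.Nat using (_≤ᵇ_)

Mat : ℕ → Set
Mat n = Fin n → Fin n → ℤ

∑ : (n : ℕ) → (Fin n → ℤ) → ℤ
∑ zero    f = + 0
∑ (suc n) f = f zero + ∑ n (λ j → f (suc j))

sgn : ℕ → ℤ
sgn zero    = + 1
sgn (suc k) = - sgn k

minor : ∀ {n} → Mat (suc n) → Fin (suc n) → Mat n
minor A j i k = A (suc i) (punchIn j k)

-- Determinant via Laplace (cofactor) expansion along the first row
-- (equal to the Leibniz determinant).
det : (n : ℕ) → Mat n → ℤ
det zero    A = + 1
det (suc n) A = ∑ (suc n) (λ j → sgn (toℕ j) * A zero j * det n (minor A j))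

-- Indicator of -2 ≤ j - i ≤ 1, with i,j natural (0- or 1-based alike)
band : ℕ → ℕ → ℤ
band i j = if (i ≤ᵇ j ℕ.+ 2) ∧ (j ≤ᵇ i ℕ.+ 1) then + 1 else + 0

-- C^(m): entries C_ij = 1 iff -2 ≤ j - i ≤ 1 (0-based indices; only differences matter)
Cmat : (m : ℕ) → Mat m
Cmat m i j = band (toℕ i) (toℕ j)

C : ℕ → ℤ
C m = det m (Cmat m)

-- K^(n): first row (0-based row 0) has 1 at paper columns 1 and n-1
-- (0-based columns 0 and n-2), 0 elsewhere; other rows are banded as in C.
Kmat : (n : ℕ) → Mat n
Kmat n zero    j = if (toℕ j ℕ.≡ᵇ 0) then + 1 else (if (toℕ j ℕ.≡ᵇ (n ℕ.∸ 2)) then + 1 else + 0)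
Kmat n (suc i) j = band (toℕ (suc i)) (toℕ j)

K : ℕ → ℤ
K n = det n (Kmat n)

module Submission where

open import Defs
open import Data.Nat using (ℕ; _≤_; _∸_)
open import Data.Integer using (ℤ; +_; _+_; _-_; _*_)
open import Relation.Binary.PropositionalEquality using (_≡_)

open import Data.Nat using (zero; suc; s≤s; z≤n; _≡ᵇ_)
open import Data.Fin using (Fin; zero; suc; toℕ; punchIn; inject₁; fromℕ)
open import Data.Fin.Properties using (toℕ-inject₁; toℕ-fromℕ; toℕ-injective; suc-injective)
open import Data.Integer using (-_)
open import Data.Integer.Properties
  using (*-zeroʳ; *-identityˡ; *-identityʳ; +-identityˡ; +-identityʳ; neg-involutive)
open import Data.Integer.Tactic.RingSolver using (solve-∀)
open import Data.Vec.Functional using (_∷_)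
open import Data.Bool using (if_then_else_)
open import Data.Empty using (⊥-elim)
open import Relation.Binary.PropositionalEquality
  using (refl; sym; trans; cong; cong₂; _≢_; module ≡-Reasoning)

-- Every matrix that occurs is, after deleting first rows and
-- columns, a "band matrix with column labels": row r has a 1 exactly in the
-- columns whose label lies in [r, r+3].  Shifting all labels by one does not
-- change such a matrix, a column labelled 0 is a unit column, and the first
-- row has ones only in the columns labelled ≤ 3.  Expanding along the first
-- row therefore turns every determinant into a short combination of smaller
-- determinants of the same kind.  This gives
--   * the recurrence  C(q+3) = C(q+2) − Δ(q),  where Δ(q) = C(q+1) − C(q),
--     hence  Δ(q+2) = −Δ(q);
--   * for the minor L(m) of K^(m+2) at its second nonzero first-row entry the
--     recurrence  L(q+3) = L(q+2) − L(q+1) + L(q),  whence  L(q+1) = Δ(q);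
--   * K(m+3) = C(m+2) + (−1)^(m+1) L(m+1).
-- The theorem is then  K(n) = C(n−1) + (−1)^n Δ(n−3)  rewritten with the
-- recurrence for C.

open ≡-Reasoning

∑-cong : ∀ n {f g : Fin n → ℤ} → (∀ j → f j ≡ g j) → ∑ n f ≡ ∑ n g
∑-cong zero    eq = refl
∑-cong (suc n) eq = cong₂ _+_ (eq zero) (∑-cong n (λ j → eq (suc j)))

∑-zero : ∀ n {f : Fin n → ℤ} → (∀ j → f j ≡ + 0) → ∑ n f ≡ + 0
∑-zero zero    eq = refl
∑-zero (suc n) eq = cong₂ _+_ (eq zero) (∑-zero n (λ j → eq (suc j)))

∑-select : ∀ n (f : Fin n → ℤ) (t : Fin n) → (∀ k → k ≢ t → f k ≡ + 0) → ∑ n f ≡ f t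
∑-select (suc n) f zero    off =
  trans (cong (λ x → f zero + x) (∑-zero n (λ k → off (suc k) (λ ())))) (+-identityʳ (f zero))
∑-select (suc n) f (suc t) off =
  trans (cong (_+ ∑ n (λ k → f (suc k))) (off zero (λ ())))
    (trans (+-identityˡ _) (∑-select n (λ k → f (suc k)) t (λ k k≢t → off (suc k) (λ e → k≢t (suc-injective e)))))

det-cong : ∀ n {A B : Mat n} → (∀ i j → A i j ≡ B i j) → det n A ≡ det n B
det-cong zero    eq = refl
det-cong (suc n) eq = ∑-cong (suc n) (λ j →
  cong₂ (λ a d → sgn (toℕ j) * a * d) (eq zero j) (det-cong n (λ i k → eq (suc i) (punchIn j k))))

expansionTerm : ∀ {n} → Mat (suc n) → Fin (suc n) → ℤ
expansionTerm {n} A j = sgn (toℕ j) * A zero j * det n (minor A j)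

term-vanishes-entry : ∀ {n} (A : Mat (suc n)) j → A zero j ≡ + 0 → expansionTerm A j ≡ + 0
term-vanishes-entry {n} A j a≡0 =
  trans (cong (λ a → sgn (toℕ j) * a * det n (minor A j)) a≡0)
        (cong (_* det n (minor A j)) (*-zeroʳ (sgn (toℕ j))))

term-vanishes-minor : ∀ {n} (A : Mat (suc n)) j → det n (minor A j) ≡ + 0 → expansionTerm A j ≡ + 0
term-vanishes-minor A j d≡0 = trans (cong (sgn (toℕ j) * A zero j *_) d≡0) (*-zeroʳ (sgn (toℕ j) * A zero j))

det-zero-column : ∀ m (A : Mat (suc m)) → (∀ i → A i zero ≡ + 0) → det (suc m) A ≡ + 0
det-zero-column zero    A col = cong (_+ + 0) (term-vanishes-entry A zero (col zero))
det-zero-column (suc m) A col = ∑-zero (suc (suc m)) vanishes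
  where
  vanishes : ∀ j → expansionTerm A j ≡ + 0
  vanishes zero    = term-vanishes-entry A zero (col zero)
  vanishes (suc j) = term-vanishes-minor A (suc j) (det-zero-column m (minor A (suc j)) (λ i → col (suc i)))

det-unit-column : ∀ m (A : Mat (suc m)) → A zero zero ≡ + 1 → (∀ i → A (suc i) zero ≡ + 0) →
  det (suc m) A ≡ det m (minor A zero)
det-unit-column zero    A a₀ col = cong (λ a → + 1 * a * + 1 + + 0) a₀
det-unit-column (suc m) A a₀ col = begin
  expansionTerm A zero + ∑ (suc m) (λ j → expansionTerm A (suc j))
    ≡⟨ cong₂ _+_ (cong (λ a → + 1 * a * d₀) a₀) (∑-zero (suc m) (λ j → term-vanishes-minor A (suc j)
         (det-zero-column m (minor A (suc j)) col))) ⟩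
  + 1 * + 1 * d₀ + + 0
    ≡⟨ trans (+-identityʳ _) (*-identityˡ d₀) ⟩
  d₀ ∎
  where d₀ = det (suc m) (minor A zero)

det-row-11 : ∀ q (A : Mat (suc (suc q))) → A zero zero ≡ + 1 → A zero (suc zero) ≡ + 1 →
  (∀ j → A zero (suc (suc j)) ≡ + 0) →
  det (suc (suc q)) A ≡ det (suc q) (minor A zero) - det (suc q) (minor A (suc zero))
det-row-11 q A a₀ a₁ rest = begin
  e₀ + (e₁ + ∑ q (λ j → expansionTerm A (suc (suc j))))
    ≡⟨ cong (λ t → e₀ + (e₁ + t)) (∑-zero q (λ j → term-vanishes-entry A (suc (suc j)) (rest j))) ⟩
  e₀ + (e₁ + + 0)
    ≡⟨ cong₂ (λ a b → + 1 * a * d₀ + (- (+ 1) * b * d₁ + + 0)) a₀ a₁ ⟩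
  + 1 * + 1 * d₀ + (- (+ 1) * + 1 * d₁ + + 0)
    ≡⟨ simplify d₀ d₁ ⟩
  d₀ - d₁ ∎
  where
  e₀ = expansionTerm A zero
  e₁ = expansionTerm A (suc zero)
  d₀ = det (suc q) (minor A zero)
  d₁ = det (suc q) (minor A (suc zero))
  simplify : ∀ a b → + 1 * + 1 * a + (- (+ 1) * + 1 * b + + 0) ≡ a - b
  simplify = solve-∀

det-row-111 : ∀ q (A : Mat (suc (suc (suc q)))) → A zero zero ≡ + 1 → A zero (suc zero) ≡ + 1 →
  A zero (suc (suc zero)) ≡ + 1 → (∀ j → A zero (suc (suc (suc j))) ≡ + 0) →
  det (suc (suc (suc q))) A ≡ det (suc (suc q)) (minor A zero) - det (suc (suc q)) (minor A (suc zero))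
                               + det (suc (suc q)) (minor A (suc (suc zero)))
det-row-111 q A a₀ a₁ a₂ rest = begin
  e₀ + (e₁ + (e₂ + ∑ q (λ j → expansionTerm A (suc (suc (suc j))))))
    ≡⟨ cong (λ t → e₀ + (e₁ + (e₂ + t))) (∑-zero q (λ j → term-vanishes-entry A (suc (suc (suc j))) (rest j))) ⟩
  e₀ + (e₁ + (e₂ + + 0))
    ≡⟨ cong₂ (λ a b → + 1 * a * d₀ + (- (+ 1) * b * d₁ + (e₂ + + 0))) a₀ a₁ ⟩
  + 1 * + 1 * d₀ + (- (+ 1) * + 1 * d₁ + (e₂ + + 0))
    ≡⟨ cong (λ c → + 1 * + 1 * d₀ + (- (+ 1) * + 1 * d₁ + (+ 1 * c * d₂ + + 0))) a₂ ⟩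
  + 1 * + 1 * d₀ + (- (+ 1) * + 1 * d₁ + (+ 1 * + 1 * d₂ + + 0))
    ≡⟨ simplify d₀ d₁ d₂ ⟩
  d₀ - d₁ + d₂ ∎
  where
  e₀ = expansionTerm A zero
  e₁ = expansionTerm A (suc zero)
  e₂ = expansionTerm A (suc (suc zero))
  d₀ = det (suc (suc q)) (minor A zero)
  d₁ = det (suc (suc q)) (minor A (suc zero))
  d₂ = det (suc (suc q)) (minor A (suc (suc zero)))
  simplify : ∀ a b c → + 1 * + 1 * a + (- (+ 1) * + 1 * b + (+ 1 * + 1 * c + + 0)) ≡ a - b + c
  simplify = solve-∀

band-suc : ∀ a b → band (suc a) (suc b) ≡ band a b
band-suc zero    zero    = refl
band-suc zero    (suc b) = refl
band-suc (suc a) zero    = refl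
band-suc (suc a) (suc b) = refl

-- The band matrix with column labels τ: row r has a 1 exactly in the columns c
-- with r ≤ τ c ≤ r + 3.
Band : ∀ {m} → (Fin m → ℕ) → Mat m
Band τ r c = band (suc (suc (toℕ r))) (τ c)

run : ∀ {m} → Fin m → ℕ
run c = suc (suc (toℕ c))

gapAt : ∀ {m} → Fin (suc m) → Fin m → ℕ
gapAt j k = suc (toℕ (punchIn j k))

C-as-Band : ∀ m → C m ≡ det m (Band run)
C-as-Band m = det-cong m (λ i j → sym (trans (band-suc (suc (toℕ i)) (suc (toℕ j))) (band-suc (toℕ i) (toℕ j))))

det-minor-Band : ∀ {m} (τ : Fin (suc m) → ℕ) (j : Fin (suc m)) (σ : Fin m → ℕ) →
  (∀ k → τ (punchIn j k) ≡ suc (σ k)) → det m (minor (Band τ) j) ≡ det m (Band σ)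
det-minor-Band {m} τ j σ eq = det-cong m (λ i k →
  trans (cong (band (suc (suc (suc (toℕ i))))) (eq k)) (band-suc (suc (suc (toℕ i))) (σ k)))

-- A column labelled 0 is a unit column and can be peeled off.
det-Band-peel : ∀ m (σ : Fin m → ℕ) →
  det (suc m) (Band (0 ∷ (λ k → suc (σ k)))) ≡ det m (Band σ)
det-Band-peel m σ =
  trans (det-unit-column m (Band (0 ∷ (λ k → suc (σ k)))) refl (λ i → refl))
        (det-minor-Band (0 ∷ (λ k → suc (σ k))) zero σ (λ k → refl))

-- The first-row minors of K^(n) are band matrices (the rows of K below the first are banded).
det-minor-Kmat : ∀ n (j : Fin (suc n)) → det n (minor (Kmat (suc n)) j) ≡ det n (Band (gapAt j))
det-minor-Kmat n j = det-cong n (λ i k → sym (band-suc (suc (toℕ i)) (toℕ (punchIn j k))))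

Δ : ℕ → ℤ
Δ q = C (suc q) - C q

-- The minor of C^(q+3) at first-row position 1 (labels 1, 3, 4, …) has determinant Δ(q).
det-gap₁ : ∀ q → det (suc (suc q)) (Band (gapAt (suc zero))) ≡ Δ q
det-gap₁ q = begin
  det (suc (suc q)) A
    ≡⟨ det-row-11 q A refl refl (λ j → refl) ⟩
  det (suc q) (minor A zero) - det (suc q) (minor A (suc zero))
    ≡⟨ cong₂ _-_ (det-minor-Band (gapAt {suc (suc q)} (suc zero)) zero run (λ k → refl))
                 (trans (det-minor-Band (gapAt {suc (suc q)} (suc zero)) (suc zero) σ gap) (det-Band-peel q run)) ⟩
  det (suc q) (Band run) - det q (Band run)
    ≡⟨ sym (cong₂ _-_ (C-as-Band (suc q)) (C-as-Band q)) ⟩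
  Δ q ∎
  where
  A : Mat (suc (suc q))
  A = Band (gapAt (suc zero))
  σ : Fin (suc q) → ℕ
  σ = 0 ∷ (λ k → suc (run k))
  gap : ∀ k → gapAt (suc zero) (punchIn (suc zero) k) ≡ suc (σ k)
  gap zero    = refl
  gap (suc k) = refl

-- The first row of C^(q+3) is (1, 1, 0, …, 0); its two minors are C^(q+2) and the
-- matrix of det-gap₁.
C-rec : ∀ q → C (suc (suc (suc q))) ≡ C (suc (suc q)) - Δ q
C-rec q = begin
  C (suc (suc (suc q)))
    ≡⟨ C-as-Band (suc (suc (suc q))) ⟩
  det (suc (suc (suc q))) (Band run)
    ≡⟨ det-row-11 (suc q) (Band run) refl refl (λ j → refl) ⟩
  det (suc (suc q)) (minor (Band run) zero) - det (suc (suc q)) (minor (Band run) (suc zero))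
    ≡⟨ cong₂ _-_ (trans (det-minor-Band {suc (suc q)} run zero run (λ k → refl)) (sym (C-as-Band (suc (suc q)))))
                 (trans (det-minor-Band {suc (suc q)} run (suc zero) (gapAt (suc zero)) (λ k → refl)) (det-gap₁ q)) ⟩
  C (suc (suc q)) - Δ q ∎

Δ-antiperiodic : ∀ q → Δ (suc (suc q)) ≡ - Δ q
Δ-antiperiodic q = trans (cong (_- C (suc (suc q))) (C-rec q)) (cancel (C (suc (suc q))) (Δ q))
  where
  cancel : ∀ c d → c - d - c ≡ - d
  cancel = solve-∀

-- L(m): the minor of K^(m+2) at its first-row entry in column m (0-based);
-- its column labels are 1, …, m, m+2.
L : ℕ → ℤ
L m = det (suc m) (Band (gapAt (inject₁ (fromℕ m))))

-- The first row of L's matrix is (1, 1, 1, 0, …, 0); peeling the columns labelled 0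
-- off its three minors leaves the matrices of L at the three preceding sizes.
L-rec : ∀ q → L (suc (suc (suc q))) ≡ L (suc (suc q)) - L (suc q) + L q
L-rec q = begin
  det (suc (suc (suc (suc q)))) A
    ≡⟨ det-row-111 (suc q) A refl refl refl (λ j → refl) ⟩
  det _ (minor A zero) - det _ (minor A (suc zero)) + det _ (minor A (suc (suc zero)))
    ≡⟨ cong₂ _+_ (cong₂ _-_ minor₀ minor₁) minor₂ ⟩
  L (suc (suc q)) - L (suc q) + L q ∎
  where
  τ : ∀ m → Fin (suc m) → ℕ
  τ m = gapAt (inject₁ (fromℕ m))
  A : Mat (suc (suc (suc (suc q))))
  A = Band (τ (suc (suc (suc q))))
  minor₀ : det _ (minor A zero) ≡ L (suc (suc q))
  minor₀ = det-minor-Band (τ (suc (suc (suc q)))) zero (τ (suc (suc q))) (λ k → refl)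
  σ₁ : Fin (suc (suc (suc q))) → ℕ
  σ₁ = 0 ∷ (λ k → suc (τ (suc q) k))
  labels₁ : ∀ k → τ (suc (suc (suc q))) (punchIn (suc zero) k) ≡ suc (σ₁ k)
  labels₁ zero    = refl
  labels₁ (suc k) = refl
  minor₁ : det _ (minor A (suc zero)) ≡ L (suc q)
  minor₁ = trans (det-minor-Band (τ (suc (suc (suc q)))) (suc zero) σ₁ labels₁) (det-Band-peel (suc (suc q)) (τ (suc q)))
  σ₂ : Fin (suc (suc q)) → ℕ
  σ₂ = 0 ∷ (λ k → suc (τ q k))
  labels₂ : ∀ k → τ (suc (suc (suc q))) (punchIn (suc (suc zero)) k) ≡ suc ((0 ∷ (λ k → suc (σ₂ k))) k)
  labels₂ zero          = refl
  labels₂ (suc zero)    = refl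
  labels₂ (suc (suc k)) = refl
  minor₂ : det _ (minor A (suc (suc zero))) ≡ L q
  minor₂ = trans (det-minor-Band (τ (suc (suc (suc q)))) (suc (suc zero)) _ labels₂)
             (trans (det-Band-peel (suc (suc q)) σ₂) (det-Band-peel (suc q) (τ q)))

-- Both L(q+1) and Δ(q) satisfy the recurrence of L, with equal initial values.
L≡Δ : ∀ q → L (suc q) ≡ Δ q
L≡Δ zero = refl
L≡Δ (suc zero) = refl
L≡Δ (suc (suc zero)) = refl
L≡Δ (suc (suc (suc q))) = begin
  L (suc (suc (suc (suc q))))
    ≡⟨ L-rec (suc q) ⟩
  L (suc (suc (suc q))) - L (suc (suc q)) + L (suc q)
    ≡⟨ cong₂ _+_ (cong₂ _-_ (L≡Δ (suc (suc q))) (L≡Δ (suc q))) (L≡Δ q) ⟩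
  Δ (suc (suc q)) - Δ (suc q) + Δ q
    ≡⟨ cong (λ x → x - Δ (suc q) + Δ q) (Δ-antiperiodic q) ⟩
  - Δ q - Δ (suc q) + Δ q
    ≡⟨ cancel (Δ q) (Δ (suc q)) ⟩
  - Δ (suc q)
    ≡⟨ sym (Δ-antiperiodic (suc q)) ⟩
  Δ (suc (suc (suc q))) ∎
  where
  cancel : ∀ a b → - a - b + a ≡ - b
  cancel = solve-∀

if-≡ᵇ-same : ∀ {A : Set} t (x y : A) → (if t ≡ᵇ t then x else y) ≡ x
if-≡ᵇ-same zero    x y = refl
if-≡ᵇ-same (suc t) x y = if-≡ᵇ-same t x y

if-≡ᵇ-distinct : ∀ {A : Set} s t (x y : A) → s ≢ t → (if s ≡ᵇ t then x else y) ≡ y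
if-≡ᵇ-distinct zero    zero    x y s≢t = ⊥-elim (s≢t refl)
if-≡ᵇ-distinct zero    (suc t) x y s≢t = refl
if-≡ᵇ-distinct (suc s) zero    x y s≢t = refl
if-≡ᵇ-distinct (suc s) (suc t) x y s≢t = if-≡ᵇ-distinct s t x y (λ e → s≢t (cong suc e))

-- The first row of K^(m+3) has ones in columns 0 and m+1 (0-based).
K-expansion : ∀ m → K (suc (suc (suc m))) ≡ C (suc (suc m)) + sgn (suc m) * L (suc m)
K-expansion m = cong₂ _+_ first-term other-terms
  where
  A : Mat (suc (suc (suc m)))
  A = Kmat (suc (suc (suc m)))
  ι : Fin (suc (suc m))
  ι = inject₁ (fromℕ m)
  toℕ-ι : toℕ ι ≡ m
  toℕ-ι = trans (toℕ-inject₁ (fromℕ m)) (toℕ-fromℕ m)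
  first-term : expansionTerm A zero ≡ C (suc (suc m))
  first-term = trans (*-identityˡ _) (trans (det-minor-Kmat (suc (suc m)) zero) (sym (C-as-Band (suc (suc m)))))
  off : ∀ k → k ≢ ι → expansionTerm A (suc k) ≡ + 0
  off k k≢ι = term-vanishes-entry A (suc k)
    (if-≡ᵇ-distinct (toℕ k) m (+ 1) (+ 0) (λ e → k≢ι (toℕ-injective (trans e (sym toℕ-ι)))))
  other-terms : ∑ (suc (suc m)) (λ k → expansionTerm A (suc k)) ≡ sgn (suc m) * L (suc m)
  other-terms = begin
    ∑ (suc (suc m)) (λ k → expansionTerm A (suc k))
      ≡⟨ ∑-select (suc (suc m)) (λ k → expansionTerm A (suc k)) ι off ⟩
    sgn (suc (toℕ ι)) * (if toℕ ι ≡ᵇ m then + 1 else + 0) * d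
      ≡⟨ cong (λ t → sgn (suc t) * (if t ≡ᵇ m then + 1 else + 0) * d) toℕ-ι ⟩
    sgn (suc m) * (if m ≡ᵇ m then + 1 else + 0) * d
      ≡⟨ cong (λ e → sgn (suc m) * e * d) (if-≡ᵇ-same m (+ 1) (+ 0)) ⟩
    sgn (suc m) * + 1 * d
      ≡⟨ cong₂ _*_ (*-identityʳ (sgn (suc m))) (det-minor-Kmat _ (suc ι)) ⟩
    sgn (suc m) * L (suc m) ∎
    where d = det (suc (suc m)) (minor A (suc ι))

-- The theorem: K(n) = C(n−1) + (−1)^n Δ(n−3), and C(n−1) = Δ(n−3) + C(n−4).
lemma2 : (n : ℕ) → 5 ≤ n →
    K n ≡ (C (n ∸ 2) - C (n ∸ 3)) * (+ 1 + sgn n) + C (n ∸ 4)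
lemma2 (suc (suc (suc (suc (suc p))))) (s≤s (s≤s (s≤s (s≤s (s≤s z≤n))))) = begin
  K (suc (suc (suc (suc (suc p)))))
    ≡⟨ K-expansion (suc (suc p)) ⟩
  C (suc (suc (suc (suc p)))) + sgn (suc (suc (suc p))) * L (suc (suc (suc p)))
    ≡⟨ cong₂ (λ c x → c + sgn (suc (suc (suc p))) * x) (C-rec (suc p)) (L≡Δ (suc (suc p))) ⟩
  C (suc (suc (suc p))) - Δ (suc p) + sgn (suc (suc (suc p))) * Δ (suc (suc p))
    ≡⟨ cong (λ s → C (suc (suc (suc p))) - Δ (suc p) + s * Δ (suc (suc p)))
            (sym (neg-involutive (sgn (suc (suc (suc p)))))) ⟩
  C (suc (suc (suc p))) - Δ (suc p) + sgn (suc (suc (suc (suc (suc p))))) * Δ (suc (suc p))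
    ≡⟨ collect (C (suc (suc (suc p)))) (C (suc (suc p))) (C (suc p)) (sgn (suc (suc (suc (suc (suc p)))))) ⟩
  Δ (suc (suc p)) * (+ 1 + sgn (suc (suc (suc (suc (suc p)))))) + C (suc p) ∎
  where
  collect : ∀ a b c s → a - (b - c) + s * (a - b) ≡ (a - b) * (+ 1 + s) + c
  collect = solve-∀
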